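{- Let $p\ge 3$ and let $q\ge 4$ be even. Then $C_p+_Q C_q$ is nearly dispersable, i.e. $\operatorname{mbt}(C_p+_Q C_q)=\Delta(C_p+_Q C_q)+1$; here $\Delta(C_p+_Q C_q)=4$, so $\operatorname{mbt}(C_p+_Q C_q)=5$.
   Context: $C_m$ denotes the cycle on $m$ vertices. Matching book embedding: the vertices are placed in a linear order along a spine and each edge is assigned to a page (half-plane bounded by the spine) so that no two edges on the same page cross and every vertex is incident with at most one edge on each page. $\operatorname{mbt}(G)$ is the minimum number of pages of a matching book embedding of $G$. $G$ is nearly dispersable if $\operatorname{mbt}(G)=\Delta(G)+1$, where $\Delta$ denotes maximum degree. For a graph $G$, $Q(G)$ is obtained by inserting a new vertex into each edge of $G$ and then joining two new vertices whenever their edges of $G$ share an endpoint; thus $V(Q(G))=V(G)\cup E(G)$. The $Q$-sum $G+_Q H$ has vertex set $(V(G)\cup E(G))\times V(H)$. Two vertices $(u_1,u_2)$ and $(v_1,v_2)$ are adjacent if and only if either $u_1=v_1\in V(G)$ and $u_2v_2\in E(H)$, or $u_2=v_2$ and $u_1v_1\in E(Q(G))$. -}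

module Defs where

open import Level using (0ℓ)
open import Data.Nat using (ℕ; zero; suc; _<_; _≤_)
open import Data.Nat.DivMod using (_mod_)
open import Data.Fin using (Fin; toℕ)
open import Data.Sum using (_⊎_; inj₁; inj₂)
open import Data.Product using (Σ; ∃; ∃-syntax; _×_; _,_)
open import Data.List using (List; length)
open import Data.List.Membership.Propositional using (_∈_)
open import Data.List.Relation.Unary.Unique.Propositional using (Unique)
open import Function.Bundles using (_↔_; Inverse; _⇔_)
open import Relation.Binary.PropositionalEquality using (_≡_; _≢_)
open import Relation.Nullary using (¬_)
open import Data.Empty using (⊥)

-- A graph given by its vertices, its edges and the two ends of each edge.
-- (Used for the first factor G of a Q-sum, where E(G) is needed.)

record EdgeGraph : Set₁ where
  field
    V   : Set
    E   : Set
    end₁ end₂ : E → V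

  _∈ₑ_ : V → E → Set
  v ∈ₑ e = (end₁ e ≡ v) ⊎ (end₂ e ≡ v)

  Adj : V → V → Set
  Adj u v = Σ E λ e → ((end₁ e ≡ u) × (end₂ e ≡ v)) ⊎ ((end₁ e ≡ v) × (end₂ e ≡ u))

record Graph : Set₁ where
  field
    V   : Set
    Adj : V → V → Set

cycSuc : ∀ {m} → Fin m → Fin m
cycSuc {suc m} i = suc (toℕ i) mod suc m

C : ℕ → EdgeGraph
C m = record { V = Fin m ; E = Fin m ; end₁ = λ i → i ; end₂ = cycSuc }

QAdj : (G : EdgeGraph) → (EdgeGraph.V G ⊎ EdgeGraph.E G) → (EdgeGraph.V G ⊎ EdgeGraph.E G) → Set
QAdj G (inj₁ u) (inj₁ v) = ⊥
QAdj G (inj₁ u) (inj₂ e) = EdgeGraph._∈ₑ_ G u e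
QAdj G (inj₂ e) (inj₁ v) = EdgeGraph._∈ₑ_ G v e
QAdj G (inj₂ e) (inj₂ f) = (e ≢ f) × (Σ (EdgeGraph.V G) λ v → EdgeGraph._∈ₑ_ G v e × EdgeGraph._∈ₑ_ G v f)

Q : EdgeGraph → Graph
Q G = record { V = EdgeGraph.V G ⊎ EdgeGraph.E G ; Adj = QAdj G }

_+Q_ : EdgeGraph → EdgeGraph → Graph
G +Q H = record
  { V   = (EdgeGraph.V G ⊎ EdgeGraph.E G) × EdgeGraph.V H
  ; Adj = λ { (u₁ , u₂) (v₁ , v₂) →
              (Σ (EdgeGraph.V G) λ w → (u₁ ≡ inj₁ w) × (v₁ ≡ inj₁ w) × EdgeGraph.Adj H u₂ v₂)
            ⊎ ((u₂ ≡ v₂) × QAdj G u₁ v₁) }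
  }

module _ (G : Graph) where
  open Graph G

  HasDegree : V → ℕ → Set
  HasDegree v d = Σ (List V) λ ns → Unique ns × (length ns ≡ d) × (∀ u → (u ∈ ns) ⇔ Adj v u)

  MaxDegree : ℕ → Set
  MaxDegree D = (∀ v → Σ ℕ λ d → HasDegree v d × (d ≤ D)) × (Σ V λ v → HasDegree v D)

  record MatchingBookEmbedding (k : ℕ) : Set where
    field
      N     : ℕ
      spine : V ↔ Fin N
      page  : ∀ u v → Adj u v → Fin k
      page-edge : ∀ u v (a : Adj u v) (b : Adj v u) → page u v a ≡ page v u b
      no-cross  : ∀ u v x y (a : Adj u v) (b : Adj x y) →
                  toℕ (Inverse.to spine u) < toℕ (Inverse.to spine x) →
                  toℕ (Inverse.to spine x) < toℕ (Inverse.to spine v) →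
                  toℕ (Inverse.to spine v) < toℕ (Inverse.to spine y) →
                  page u v a ≢ page x y b
      matching  : ∀ u v w (a : Adj u v) (b : Adj u w) → v ≢ w → page u v a ≢ page u w b

  MBT : ℕ → Set
  MBT k = MatchingBookEmbedding k × (∀ j → j < k → ¬ MatchingBookEmbedding j)

  NearlyDispersable : Set
  NearlyDispersable = Σ ℕ λ D → MaxDegree D × MBT (suc D)

-- Write v_i for the vertices of C_p and e_j for the vertex of Q(C_p) on the edge v_j v_{j+1}.
-- Every vertex of C_p +_Q C_q has degree 4, so four pages are needed.  Four pages do not suffice:
-- every page would then be a perfect matching, and in a crossing-free perfect matching the vertices
-- strictly inside an arc are matched among themselves, so every arc joins spine positions of
-- opposite parity, which the triangle v_0 e_0 e_{p-1} forbids.  Five pages suffice: the q copies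
-- of Q(C_p) follow each other along the spine, alternately reversed.  The edges of C_q and the
-- edges e_j e_{j+1} (j ≥ 1) alternate between two pages according to parity, consistently around
-- C_q because q is even, while the edges v_i e_i, the edges v_{j+1} e_j, and the pair v_0 e_{p-1},
-- e_0 e_1 fill the remaining three pages with concentric or adjacent arcs within each copy.

module Submission where

open import Defs
open import Data.Nat using (ℕ; zero; suc; _+_; _*_; _<_; _≤_; _%_; s≤s; z≤n; s≤s⁻¹)
open import Data.Nat.Base using (parity)
open import Data.Nat.Properties
open import Data.Nat.DivMod using (m<n⇒m%n≡m; n%n≡0)
open import Data.Nat.Divisibility using (_∣_; divides)
open import Data.Nat.Tactic.RingSolver using (solve-∀)
open import Data.Parity using (Parity; 0ℙ; 1ℙ; _⁻¹)
open import Data.Parity.Properties using (⁻¹-selfInverse; ⁻¹-involutive; p≢p⁻¹; suc-homo-⁻¹)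
open import Data.Fin
  using (Fin; zero; suc; toℕ; fromℕ; fromℕ<; inject₁; opposite; _↑ˡ_; _↑ʳ_; splitAt; join
        ; combine; remQuot)
open import Data.Fin.Patterns using (0F; 1F; 2F; 3F; 4F)
open import Data.Fin.Properties
  using ( injective⇒≤; any?; toℕ-injective; toℕ<n; toℕ-fromℕ<; toℕ-fromℕ; toℕ-inject₁; toℕ-combine
        ; toℕ-↑ˡ; toℕ-↑ʳ; opposite-involutive; opposite-prop; splitAt-↑ˡ; splitAt-↑ʳ; join-splitAt
        ; remQuot-combine; combine-remQuot)
import Data.Fin.Properties as Fin
open import Data.List using (tabulate)
open import Data.List.Properties using (length-tabulate)
open import Data.List.Membership.Propositional using (_∈_)
open import Data.List.Membership.Propositional.Properties using (∈-tabulate⁺; ∈-tabulate⁻)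
open import Data.List.Relation.Unary.All using ([]; _∷_)
open import Data.List.Relation.Unary.All.Properties using (tabulate⁻)
open import Data.List.Relation.Unary.AllPairs using ([]; _∷_)
open import Data.List.Relation.Unary.Unique.Propositional using (Unique)
open import Data.Product using (∃; ∃₂; _×_; _,_; proj₁; proj₂; uncurry)
open import Data.Product.Properties using (,-injectiveˡ; ,-injectiveʳ)
open import Data.Sum using (_⊎_; inj₁; inj₂)
import Data.Sum as Sum
open import Data.Sum.Properties using (inj₁-injective; inj₂-injective)
open import Data.Empty using (⊥; ⊥-elim)
open import Function.Base using (_∘′_; id)
open import Function.Bundles using (_↔_; Inverse; mk⇔; mk↔ₛ′)
open import Function.Definitions using (Injective)
open import Relation.Binary.Definitions using (tri<; tri≈; tri>)
open import Relation.Binary.PropositionalEquality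
open import Relation.Nullary using (¬_; yes; no; contradiction)

private variable
  A : Set
  k : ℕ

Unique-tabulate⇒injective : {f : Fin k → A} → Unique (tabulate f) → Injective _≡_ _≡_ f
Unique-tabulate⇒injective _       {zero}  {zero}  _  = refl
Unique-tabulate⇒injective (d ∷ _) {zero}  {suc j} eq = contradiction eq (tabulate⁻ d j)
Unique-tabulate⇒injective (d ∷ _) {suc i} {zero}  eq = contradiction (sym eq) (tabulate⁻ d i)
Unique-tabulate⇒injective (_ ∷ u) {suc i} {suc j} eq = cong suc (Unique-tabulate⇒injective u eq)

injective⇒surjective : {f : Fin k → Fin k} → Injective _≡_ _≡_ f → ∀ c → ∃ λ i → f i ≡ c
injective⇒surjective {k} {f} f-inj c with any? (λ i → f i Fin.≟ c)
... | yes hit  = hit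
... | no  miss = contradiction (injective⇒≤ g-inj) 1+n≰n
  where
  g : Fin (suc k) → Fin k
  g zero    = c
  g (suc i) = f i
  g-inj : Injective _≡_ _≡_ g
  g-inj {zero}  {zero}  _  = refl
  g-inj {zero}  {suc j} eq = contradiction (j , sym eq) miss
  g-inj {suc i} {zero}  eq = contradiction (i , eq) miss
  g-inj {suc i} {suc j} eq = cong suc (f-inj eq)

parity-suc : ∀ n → parity (suc n) ≡ parity n ⁻¹
parity-suc n = sym (⁻¹-selfInverse (suc-homo-⁻¹ n))

parity-double : ∀ k → parity (k * 2) ≡ 0ℙ
parity-double zero    = refl
parity-double (suc k) = parity-double k

2∣suc⇒parity≡1ℙ : ∀ {n} → 2 ∣ suc n → parity n ≡ 1ℙ
2∣suc⇒parity≡1ℙ {n} (divides k eq) =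
  sym (⁻¹-selfInverse (trans (sym (parity-suc n)) (trans (cong parity eq) (parity-double k))))

opposite-sum : (x : Fin (suc k)) → toℕ (opposite x) + toℕ x ≡ k
opposite-sum x = trans (cong (_+ toℕ x) (opposite-prop x)) (m∸n+n≡m (s≤s⁻¹ (toℕ<n x)))

toℕ-opposite-last : {x : Fin (suc k)} → toℕ x ≡ k → toℕ (opposite x) ≡ 0
toℕ-opposite-last {k} {x} x≡k =
  +-cancelʳ-≡ k (toℕ (opposite x)) 0 (trans (cong (toℕ (opposite x) +_) (sym x≡k)) (opposite-sum x))

toℕ-opposite-first : {x : Fin (suc k)} → toℕ x ≡ 0 → toℕ (opposite x) ≡ k
toℕ-opposite-first {x = x} x≡0 =
  trans (sym (+-identityʳ _)) (trans (cong (toℕ (opposite x) +_) (sym x≡0)) (opposite-sum x))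

-- Matching book embeddings of arbitrary graphs

module _ (G : Graph) where
  open Graph G

  record Neighbourhood (v : V) (d : ℕ) : Set where
    field
      neighbour : Fin d → V
      unique    : Unique (tabulate neighbour)
      adjacent  : ∀ i → Adj v (neighbour i)
      complete  : ∀ {u} → Adj v u → ∃ λ i → u ≡ neighbour i

    neighbour-injective : Injective _≡_ _≡_ neighbour
    neighbour-injective = Unique-tabulate⇒injective unique

  Neighbourhood⇒HasDegree : ∀ {v d} → Neighbourhood v d → HasDegree G v d
  Neighbourhood⇒HasDegree N = tabulate neighbour , unique , length-tabulate neighbour ,
    λ u → mk⇔ (λ u∈ → let i , u≡ = ∈-tabulate⁻ u∈ in subst (Adj _) (sym u≡) (adjacent i))
              (λ a → let i , u≡ = complete a in subst (_∈ _) (sym u≡) (∈-tabulate⁺ i))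
    where open Neighbourhood N

  module Pages {k : ℕ} (E : MatchingBookEmbedding G k) where
    open MatchingBookEmbedding E

    position : V → ℕ
    position v = toℕ (Inverse.to spine v)

    position-injective : ∀ {u v} → position u ≡ position v → u ≡ v
    position-injective {u} {v} eq = begin
      u                                       ≡⟨ Inverse.strictlyInverseʳ spine u ⟨
      Inverse.from spine (Inverse.to spine u) ≡⟨ cong (Inverse.from spine) (toℕ-injective eq) ⟩
      Inverse.from spine (Inverse.to spine v) ≡⟨ Inverse.strictlyInverseʳ spine v ⟩
      v                                       ∎
      where open ≡-Reasoning

    vertexAt : ∀ t → t < N → V
    vertexAt t t<N = Inverse.from spine (fromℕ< t<N)

    position-vertexAt : ∀ t (t<N : t < N) → position (vertexAt t t<N) ≡ t
    position-vertexAt t t<N =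
      trans (cong toℕ (Inverse.strictlyInverseˡ spine (fromℕ< t<N))) (toℕ-fromℕ< t<N)

    position<N : ∀ v → position v < N
    position<N v = toℕ<n (Inverse.to spine v)

    module _ {v d} (Nv : Neighbourhood v d) where
      open Neighbourhood Nv

      neighbourPage : Fin d → Fin k
      neighbourPage i = page v (neighbour i) (adjacent i)

      neighbourPage-injective : Injective _≡_ _≡_ neighbourPage
      neighbourPage-injective {i} {j} eq with i Fin.≟ j
      ... | yes i≡j = i≡j
      ... | no  i≢j = contradiction eq
        (matching v (neighbour i) (neighbour j) (adjacent i) (adjacent j) (i≢j ∘′ neighbour-injective))

      degree≤pages : d ≤ k
      degree≤pages = injective⇒≤ neighbourPage-injective

    every-page-at-full-degree : ∀ {v} → Neighbourhood v k →
                                ∀ c → ∃₂ λ u (a : Adj v u) → page v u a ≡ c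
    every-page-at-full-degree Nv c =
      let i , eq = injective⇒surjective (neighbourPage-injective Nv) c
      in Neighbourhood.neighbour Nv i , Neighbourhood.adjacent Nv i , eq

    module PerfectPage (adj-sym : ∀ {u v} → Adj u v → Adj v u) (adj-irrefl : ∀ {u} → ¬ Adj u u)
                       (c : Fin k) (perfect : ∀ v → ∃₂ λ u (a : Adj v u) → page v u a ≡ c) where

      partner : V → V
      partner v = proj₁ (perfect v)

      partner-adj : ∀ v → Adj v (partner v)
      partner-adj v = proj₁ (proj₂ (perfect v))

      partner-page : ∀ v → page v (partner v) (partner-adj v) ≡ c
      partner-page v = proj₂ (proj₂ (perfect v))

      π : V → ℕ
      π = position

      partner-unique : ∀ {v u} (a : Adj v u) → page v u a ≡ c → u ≡ partner v
      partner-unique {v} {u} a pa with π u ≟ π (partner v)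
      ... | yes eq = position-injective eq
      ... | no  ne = contradiction (trans pa (sym (partner-page v)))
                       (matching v u (partner v) a (partner-adj v) (ne ∘′ cong π))

      partner-adj⁻¹ : ∀ v → Adj (partner v) v
      partner-adj⁻¹ v = adj-sym (partner-adj v)

      partner-page⁻¹ : ∀ v → page (partner v) v (partner-adj⁻¹ v) ≡ c
      partner-page⁻¹ v = trans (sym (page-edge _ _ (partner-adj v) (partner-adj⁻¹ v))) (partner-page v)

      partner-involutive : ∀ v → partner (partner v) ≡ v
      partner-involutive v = sym (partner-unique (partner-adj⁻¹ v) (partner-page⁻¹ v))

      partner-swap : ∀ {u v} → π (partner u) ≡ π v → u ≡ partner v
      partner-swap {u} eq = trans (sym (partner-involutive u)) (cong partner (position-injective eq))

      partner-injective : ∀ {u v} → π (partner u) ≡ π (partner v) → u ≡ v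
      partner-injective {v = v} eq = trans (partner-swap eq) (partner-involutive v)

      partner-irrefl : ∀ v → π (partner v) ≢ π v
      partner-irrefl v eq = adj-irrefl (subst (Adj v) (position-injective eq) (partner-adj v))

      no-crossing : ∀ {u v x y} (a : Adj u v) (b : Adj x y) → page u v a ≡ c → page x y b ≡ c →
                    π u < π x → π x < π v → ¬ π v < π y
      no-crossing a b pa pb ux xv vy = no-cross _ _ _ _ a b ux xv vy (trans pa (sym pb))

      Closed : ℕ → ℕ → Set
      Closed lo hi = ∀ z → lo < π z → π z < hi → lo < π (partner z) × π (partner z) < hi

      arc-closed : ∀ u → Closed (π u) (π (partner u))
      arc-closed u z uz zu′ = lower , upper
        where
        lower : π u < π (partner z)
        lower with <-cmp (π (partner z)) (π u)
        ... | tri> _ _ gt = gt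
        ... | tri≈ _ eq _ = ⊥-elim (<-irrefl (cong π (partner-swap eq)) zu′)
        ... | tri< lt _ _ = ⊥-elim (no-crossing (partner-adj⁻¹ z) (partner-adj u)
                                      (partner-page⁻¹ z) (partner-page u) lt uz zu′)
        upper : π (partner z) < π (partner u)
        upper with <-cmp (π (partner z)) (π (partner u))
        ... | tri< lt _ _ = lt
        ... | tri≈ _ eq _ = ⊥-elim (<-irrefl (cong π (sym (partner-injective eq))) uz)
        ... | tri> _ _ gt = ⊥-elim (no-crossing (partner-adj u) (partner-adj z)
                                      (partner-page u) (partner-page z) uz zu′ gt)

      closed-after-arc : ∀ {lo hi} u → Closed lo hi → π u ≡ suc lo → π u < π (partner u) →
                         Closed (π (partner u)) hi
      closed-after-arc {lo} u cl u≡ uu′ z u′z zh = lower , proj₂ (cl z lo<z zh)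
        where
        u<z : π u < π z
        u<z = <-trans uu′ u′z
        lo<z : lo < π z
        lo<z = <-trans (subst (lo <_) (sym u≡) (n<1+n lo)) u<z
        lower : π (partner u) < π (partner z)
        lower with <-cmp (π (partner z)) (π (partner u))
        ... | tri> _ _ gt = gt
        ... | tri≈ _ eq _ = ⊥-elim (<-irrefl (cong π (sym (partner-injective eq))) u<z)
        ... | tri< lt _ _ with m≤n⇒m<n∨m≡n (subst (_≤ π (partner z)) (sym u≡) (proj₁ (cl z lo<z zh)))
        ...   | inj₂ eq = ⊥-elim (<-irrefl (cong π (sym (partner-swap (sym eq)))) u′z)
        ...   | inj₁ ul = ⊥-elim (no-crossing (partner-adj u) (partner-adj⁻¹ z)
                                    (partner-page u) (partner-page⁻¹ z) ul lt u′z)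

      -- The vertex just after lo and its partner split (lo , hi) into two closed intervals.
      closed⇒parity-flips : ∀ fuel {lo hi} → hi ≤ lo + fuel → lo < hi → hi ≤ N → Closed lo hi →
                            parity hi ≡ parity lo ⁻¹
      closed⇒parity-flips zero {lo} {hi} hi≤ lo<hi _ _ =
        ⊥-elim (<⇒≱ lo<hi (subst (hi ≤_) (+-identityʳ lo) hi≤))
      closed⇒parity-flips (suc fuel) {lo} {hi} hi≤ lo<hi hi≤N cl with m≤n⇒m<n∨m≡n lo<hi
      ... | inj₂ refl = parity-suc lo
      ... | inj₁ 1+lo<hi = begin
        parity hi                  ≡⟨ closed⇒parity-flips fuel hi≤mid+fuel mid<hi hi≤N
                                        (closed-after-arc u cl u≡ u<mid) ⟩
        parity (π (partner u)) ⁻¹  ≡⟨ cong _⁻¹ (closed⇒parity-flips fuel mid≤u+fuel u<mid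
                                        (<⇒≤ (position<N _)) (arc-closed u)) ⟩
        parity (π u) ⁻¹ ⁻¹         ≡⟨ ⁻¹-involutive _ ⟩
        parity (π u)               ≡⟨ cong parity u≡ ⟩
        parity (suc lo)            ≡⟨ parity-suc lo ⟩
        parity lo ⁻¹               ∎
        where
        open ≡-Reasoning
        1+lo<N : suc lo < N
        1+lo<N = <-≤-trans 1+lo<hi hi≤N
        u : V
        u = vertexAt (suc lo) 1+lo<N
        u≡ : π u ≡ suc lo
        u≡ = position-vertexAt (suc lo) 1+lo<N
        inside : lo < π (partner u) × π (partner u) < hi
        inside = cl u (subst (lo <_) (sym u≡) (n<1+n lo)) (subst (_< hi) (sym u≡) 1+lo<hi)
        u<mid : π u < π (partner u)
        u<mid = ≤∧≢⇒< (subst (_≤ π (partner u)) (sym u≡) (proj₁ inside)) (partner-irrefl u ∘′ sym)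
        mid<hi : π (partner u) < hi
        mid<hi = proj₂ inside
        hi≤1+lo+fuel : hi ≤ suc lo + fuel
        hi≤1+lo+fuel = subst (hi ≤_) (+-suc lo fuel) hi≤
        mid≤u+fuel : π (partner u) ≤ π u + fuel
        mid≤u+fuel = subst (λ t → π (partner u) ≤ t + fuel) (sym u≡)
                           (<⇒≤ (<-≤-trans mid<hi hi≤1+lo+fuel))
        hi≤mid+fuel : hi ≤ π (partner u) + fuel
        hi≤mid+fuel = ≤-trans hi≤1+lo+fuel (+-monoˡ-≤ fuel (subst (_≤ π (partner u)) u≡ (<⇒≤ u<mid)))

      parity-flips-along-arc : ∀ v → π v < π (partner v) → parity (π (partner v)) ≡ parity (π v) ⁻¹
      parity-flips-along-arc v lt =
        closed⇒parity-flips (π (partner v)) (m≤n+m _ _) lt (<⇒≤ (position<N _)) (arc-closed v)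

      partner-parity : ∀ v → parity (π (partner v)) ≡ parity (π v) ⁻¹
      partner-parity v with <-cmp (π v) (π (partner v))
      ... | tri< lt _ _ = parity-flips-along-arc v lt
      ... | tri≈ _ eq _ = ⊥-elim (partner-irrefl v (sym eq))
      ... | tri> _ _ gt = sym (⁻¹-selfInverse (sym flipped))
        where
        involution : partner (partner v) ≡ v
        involution = partner-involutive v
        flipped : parity (π v) ≡ parity (π (partner v)) ⁻¹
        flipped = subst (λ w → parity (π w) ≡ parity (π (partner v)) ⁻¹) involution
          (parity-flips-along-arc (partner v) (subst (λ w → π (partner v) < π w) (sym involution) gt))

      page-parity : ∀ {u v} (a : Adj u v) → page u v a ≡ c → parity (π v) ≡ parity (π u) ⁻¹
      page-parity {u} a pa rewrite partner-unique a pa = partner-parity u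

  module _ (adj-sym : ∀ {u v} → Adj u v → Adj v u) (adj-irrefl : ∀ {u} → ¬ Adj u u) where

    regular-with-triangle⇒no-embedding : ∀ {k x y z} → (∀ v → Neighbourhood v k) →
      Adj x y → Adj y z → Adj x z → ¬ MatchingBookEmbedding G k
    regular-with-triangle⇒no-embedding {x = x} {y} {z} nbh xy yz xz E =
      p≢p⁻¹ (parity (position x)) (begin
      parity (position x)          ≡⟨ ⁻¹-involutive _ ⟨
      parity (position x) ⁻¹ ⁻¹    ≡⟨ cong _⁻¹ (flips xy) ⟨
      parity (position y) ⁻¹       ≡⟨ flips yz ⟨
      parity (position z)          ≡⟨ flips xz ⟩
      parity (position x) ⁻¹       ∎)
      where
      open ≡-Reasoning
      open MatchingBookEmbedding E using (page)
      open Pages E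
      flips : ∀ {u v} (a : Adj u v) → parity (position v) ≡ parity (position u) ⁻¹
      flips {u} {v} a = PerfectPage.page-parity adj-sym adj-irrefl (page u v a)
        (λ w → every-page-at-full-degree (nbh w) (page u v a)) a refl

    regular-with-triangle⇒pages>degree : ∀ {d x y z} → (∀ v → Neighbourhood v d) →
      Adj x y → Adj y z → Adj x z → ∀ k → k < suc d → ¬ MatchingBookEmbedding G k
    regular-with-triangle⇒pages>degree {x = x} nbh xy yz xz k k<1+d E
      with m≤n⇒m<n∨m≡n (s≤s⁻¹ k<1+d)
    ... | inj₁ k<d  = <⇒≱ k<d (Pages.degree≤pages E (nbh x))
    ... | inj₂ refl = regular-with-triangle⇒no-embedding nbh xy yz xz E

-- The cyclic successor on Fin (suc k)

data CycSucView (i : Fin (suc k)) : Set where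
  step : toℕ i < k → toℕ (cycSuc i) ≡ suc (toℕ i) → CycSucView i
  wrap : toℕ i ≡ k → toℕ (cycSuc i) ≡ 0 → CycSucView i

cycSucView : (i : Fin (suc k)) → CycSucView i
cycSucView {k} i with m≤n⇒m<n∨m≡n (s≤s⁻¹ (toℕ<n i))
... | inj₁ i<k = step i<k (trans (toℕ-fromℕ< _) (m<n⇒m%n≡m (s≤s i<k)))
... | inj₂ i≡k =
  wrap i≡k (trans (toℕ-fromℕ< _) (trans (cong (λ t → suc t % suc k) i≡k) (n%n≡0 (suc k))))

cycSuc-injective : {i j : Fin (suc k)} → cycSuc i ≡ cycSuc j → i ≡ j
cycSuc-injective {i = i} {j} eq with cycSucView i | cycSucView j
... | step _ si | step _ sj = toℕ-injective (suc-injective (trans (sym si) (trans (cong toℕ eq) sj)))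
... | step _ si | wrap _ sj = ⊥-elim (0≢1+n (trans (sym sj) (trans (cong toℕ (sym eq)) si)))
... | wrap _ si | step _ sj = ⊥-elim (0≢1+n (trans (sym si) (trans (cong toℕ eq) sj)))
... | wrap i≡ _ | wrap j≡ _ = toℕ-injective (trans i≡ (sym j≡))

cycSuc-irrefl : 1 ≤ k → (i : Fin (suc k)) → cycSuc i ≢ i
cycSuc-irrefl 1≤k i eq with cycSucView i
... | step _ si  = 1+n≢n (trans (sym si) (cong toℕ eq))
... | wrap i≡ si = <⇒≢ 1≤k (trans (sym si) (trans (cong toℕ eq) i≡))

cycSuc²-irrefl : 2 ≤ k → (i : Fin (suc k)) → cycSuc (cycSuc i) ≢ i
cycSuc²-irrefl 2≤k i eq with cycSucView i | cycSucView (cycSuc i)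
... | step _ si  | step _ ssi  =
  <⇒≢ (<-trans (n<1+n (toℕ i)) (n<1+n _)) (trans (sym (cong toℕ eq)) (trans ssi (cong suc si)))
... | step _ si  | wrap si≡ ssi =
  <⇒≢ 2≤k (trans (cong suc (sym (trans (sym (cong toℕ eq)) ssi))) (trans (sym si) si≡))
... | wrap i≡ si | step _ ssi  =
  <⇒≢ 2≤k (trans (trans (cong suc (sym si)) (sym ssi)) (trans (cong toℕ eq) i≡))
... | wrap _ si  | wrap si≡ _  = <⇒≢ (≤-trans (s≤s z≤n) 2≤k) (trans (sym si) si≡)

toℕ-cycSuc-step : {i : Fin (suc k)} → toℕ i < k → toℕ (cycSuc i) ≡ suc (toℕ i)
toℕ-cycSuc-step {i = i} i<k with cycSucView i
... | step _ si  = si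
... | wrap i≡ _ = ⊥-elim (<⇒≢ i<k i≡)

toℕ-cycSuc-wrap : {i : Fin (suc k)} → toℕ i ≡ k → toℕ (cycSuc i) ≡ 0
toℕ-cycSuc-wrap {i = i} i≡k with cycSucView i
... | step i<k _ = ⊥-elim (<⇒≢ i<k i≡k)
... | wrap _ si  = si

cycPred : Fin (suc k) → Fin (suc k)
cycPred {k}     zero    = fromℕ k
cycPred {suc k} (suc i) = inject₁ i

cycSuc-cycPred : (i : Fin (suc k)) → cycSuc (cycPred i) ≡ i
cycSuc-cycPred {k}     zero    = toℕ-injective (toℕ-cycSuc-wrap (toℕ-fromℕ k))
cycSuc-cycPred {suc k} (suc i) = toℕ-injective (trans (toℕ-cycSuc-step i<) (cong suc (toℕ-inject₁ i)))
  where
  i< : toℕ (inject₁ i) < suc k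
  i< = subst (_< suc k) (sym (toℕ-inject₁ i)) (toℕ<n i)

cycPred-cycSuc : (i : Fin (suc k)) → cycPred (cycSuc i) ≡ i
cycPred-cycSuc i = cycSuc-injective (cycSuc-cycPred (cycSuc i))

cycSuc-parity : parity k ≡ 1ℙ → (i : Fin (suc k)) → parity (toℕ (cycSuc i)) ≡ parity (toℕ i) ⁻¹
cycSuc-parity odd i with cycSucView i
... | step _ si  = trans (cong parity si) (parity-suc (toℕ i))
... | wrap i≡ si = trans (cong parity si) (cong _⁻¹ (sym (trans (cong parity i≡) odd)))

cycSuc≡zero⇒last : {j : Fin (suc k)} → cycSuc j ≡ zero → toℕ j ≡ k
cycSuc≡zero⇒last {j = j} eq with cycSucView j
... | step _ sj  = ⊥-elim (0≢1+n (trans (cong toℕ (sym eq)) sj))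
... | wrap j≡ _ = j≡

cycSuc≡suc⇒toℕ : {i : Fin k} {j : Fin (suc k)} → cycSuc j ≡ suc i → toℕ i ≡ toℕ j
cycSuc≡suc⇒toℕ {j = j} eq with cycSucView j
... | step _ sj = suc-injective (trans (cong toℕ (sym eq)) sj)
... | wrap _ sj = ⊥-elim (0≢1+n (trans (sym sj) (cong toℕ eq)))

cycSuc≢cycPred : 2 ≤ k → (i : Fin (suc k)) → cycSuc i ≢ cycPred i
cycSuc≢cycPred 2≤k i eq = cycSuc²-irrefl 2≤k i (trans (cong cycSuc eq) (cycSuc-cycPred i))

cycPred-irrefl : 1 ≤ k → (i : Fin (suc k)) → i ≢ cycPred i
cycPred-irrefl 1≤k i eq = cycSuc-irrefl 1≤k i (trans (cong cycSuc eq) (cycSuc-cycPred i))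

cycPred-unique : {i j : Fin (suc k)} → i ≡ cycSuc j → j ≡ cycPred i
cycPred-unique refl = sym (cycPred-cycSuc _)

module QSumOfCycles (m n : ℕ) (2≤m : 2 ≤ m) (2≤n : 2 ≤ n) where

  p q : ℕ
  p = suc m
  q = suc n

  G : Graph
  G = C p +Q C q

  open Graph G using (Adj) renaming (V to Vertex)

  1≤m : 1 ≤ m
  1≤m = ≤-trans (s≤s z≤n) 2≤m

  1≤n : 1 ≤ n
  1≤n = ≤-trans (s≤s z≤n) 2≤n

  -- In layer h, inj₁ i is the vertex v_i of C_p and inj₂ j the vertex e_j of Q(C_p) subdividing
  -- v_j v_{j+1}: tail and head edges join e_j to v_j and to v_{j+1}, line edges join e_j to e_{j+1},
  -- and column edges join the copies of v_i in consecutive layers.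
  data Edge : Vertex → Vertex → Set where
    column⁺ : ∀ i h h′ → h′ ≡ cycSuc h → Edge (inj₁ i , h) (inj₁ i , h′)
    column⁻ : ∀ i h h′ → h ≡ cycSuc h′ → Edge (inj₁ i , h) (inj₁ i , h′)
    tail⁺   : ∀ i h → Edge (inj₁ i , h) (inj₂ i , h)
    tail⁻   : ∀ i h → Edge (inj₂ i , h) (inj₁ i , h)
    head⁺   : ∀ i j h → cycSuc j ≡ i → Edge (inj₁ i , h) (inj₂ j , h)
    head⁻   : ∀ i j h → cycSuc j ≡ i → Edge (inj₂ j , h) (inj₁ i , h)
    line⁺   : ∀ j j′ h → j′ ≡ cycSuc j → Edge (inj₂ j , h) (inj₂ j′ , h)
    line⁻   : ∀ j j′ h → j ≡ cycSuc j′ → Edge (inj₂ j , h) (inj₂ j′ , h)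

  Adj⇒Edge : ∀ {u v} → Adj u v → Edge u v
  Adj⇒Edge (inj₁ (i , refl , refl , h , inj₁ (refl , refl))) = column⁺ i h (cycSuc h) refl
  Adj⇒Edge (inj₁ (i , refl , refl , h , inj₂ (refl , refl))) = column⁻ i (cycSuc h) h refl
  Adj⇒Edge {inj₁ _ , _} {inj₁ _ , _} (inj₂ (refl , ()))
  Adj⇒Edge {inj₁ _ , h} {inj₂ j , _} (inj₂ (refl , inj₁ refl)) = tail⁺ j h
  Adj⇒Edge {inj₁ i , h} {inj₂ j , _} (inj₂ (refl , inj₂ eq))   = head⁺ i j h eq
  Adj⇒Edge {inj₂ j , h} {inj₁ _ , _} (inj₂ (refl , inj₁ refl)) = tail⁻ j h
  Adj⇒Edge {inj₂ j , h} {inj₁ i , _} (inj₂ (refl , inj₂ eq))   = head⁻ i j h eq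
  Adj⇒Edge {inj₂ j , h} {inj₂ j′ , _} (inj₂ (refl , j≢j′ , _ , inj₁ t , inj₁ t′)) =
    ⊥-elim (j≢j′ (trans t (sym t′)))
  Adj⇒Edge {inj₂ j , h} {inj₂ j′ , _} (inj₂ (refl , _ , _ , inj₁ t , inj₂ t′)) =
    line⁻ j j′ h (trans t (sym t′))
  Adj⇒Edge {inj₂ j , h} {inj₂ j′ , _} (inj₂ (refl , _ , _ , inj₂ t , inj₁ t′)) =
    line⁺ j j′ h (trans t′ (sym t))
  Adj⇒Edge {inj₂ j , h} {inj₂ j′ , _} (inj₂ (refl , j≢j′ , _ , inj₂ t , inj₂ t′)) =
    ⊥-elim (j≢j′ (cycSuc-injective (trans t (sym t′))))

  Edge⇒Adj : ∀ {u v} → Edge u v → Adj u v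
  Edge⇒Adj (column⁺ i h _ refl) = inj₁ (i , refl , refl , h , inj₁ (refl , refl))
  Edge⇒Adj (column⁻ i _ h refl) = inj₁ (i , refl , refl , h , inj₂ (refl , refl))
  Edge⇒Adj (tail⁺ i h)          = inj₂ (refl , inj₁ refl)
  Edge⇒Adj (tail⁻ i h)          = inj₂ (refl , inj₁ refl)
  Edge⇒Adj (head⁺ i j h eq)     = inj₂ (refl , inj₂ eq)
  Edge⇒Adj (head⁻ i j h eq)     = inj₂ (refl , inj₂ eq)
  Edge⇒Adj (line⁺ j _ h refl)   = inj₂ (refl , cycSuc-irrefl 1≤m j ∘′ sym , _ , inj₂ refl , inj₁ refl)
  Edge⇒Adj (line⁻ _ j h refl)   = inj₂ (refl , cycSuc-irrefl 1≤m j , _ , inj₁ refl , inj₂ refl)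

  Edge-flip : ∀ {u v} → Edge u v → Edge v u
  Edge-flip (column⁺ i h h′ eq) = column⁻ i h′ h eq
  Edge-flip (column⁻ i h h′ eq) = column⁺ i h′ h eq
  Edge-flip (tail⁺ i h)         = tail⁻ i h
  Edge-flip (tail⁻ i h)         = tail⁺ i h
  Edge-flip (head⁺ i j h eq)    = head⁻ i j h eq
  Edge-flip (head⁻ i j h eq)    = head⁺ i j h eq
  Edge-flip (line⁺ j j′ h eq)   = line⁻ j′ j h eq
  Edge-flip (line⁻ j j′ h eq)   = line⁺ j′ j h eq

  Edge-irrefl : ∀ {u} → ¬ Edge u u
  Edge-irrefl (column⁺ _ h _ eq) = cycSuc-irrefl 1≤n h (sym eq)
  Edge-irrefl (column⁻ _ h _ eq) = cycSuc-irrefl 1≤n h (sym eq)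
  Edge-irrefl (line⁺ j _ _ eq)   = cycSuc-irrefl 1≤m j (sym eq)
  Edge-irrefl (line⁻ j _ _ eq)   = cycSuc-irrefl 1≤m j (sym eq)

  Adj-sym : ∀ {u v} → Adj u v → Adj v u
  Adj-sym = Edge⇒Adj ∘′ Edge-flip ∘′ Adj⇒Edge

  Adj-irrefl : ∀ {u} → ¬ Adj u u
  Adj-irrefl = Edge-irrefl ∘′ Adj⇒Edge

  neighbour : Vertex → Fin 4 → Vertex
  neighbour (inj₁ i , h) 0F = inj₁ i , cycSuc h
  neighbour (inj₁ i , h) 1F = inj₁ i , cycPred h
  neighbour (inj₁ i , h) 2F = inj₂ i , h
  neighbour (inj₁ i , h) 3F = inj₂ (cycPred i) , h
  neighbour (inj₂ j , h) 0F = inj₁ j , h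
  neighbour (inj₂ j , h) 1F = inj₁ (cycSuc j) , h
  neighbour (inj₂ j , h) 2F = inj₂ (cycSuc j) , h
  neighbour (inj₂ j , h) 3F = inj₂ (cycPred j) , h

  neighbour-edge : ∀ u k → Edge u (neighbour u k)
  neighbour-edge (inj₁ i , h) 0F = column⁺ i h _ refl
  neighbour-edge (inj₁ i , h) 1F = column⁻ i h _ (sym (cycSuc-cycPred h))
  neighbour-edge (inj₁ i , h) 2F = tail⁺ i h
  neighbour-edge (inj₁ i , h) 3F = head⁺ i _ h (cycSuc-cycPred i)
  neighbour-edge (inj₂ j , h) 0F = tail⁻ j h
  neighbour-edge (inj₂ j , h) 1F = head⁻ _ j h refl
  neighbour-edge (inj₂ j , h) 2F = line⁺ j _ h refl
  neighbour-edge (inj₂ j , h) 3F = line⁻ j _ h (sym (cycSuc-cycPred j))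

  edgeIndex : ∀ {u v} → Edge u v → Fin 4
  edgeIndex (column⁺ _ _ _ _) = 0F
  edgeIndex (column⁻ _ _ _ _) = 1F
  edgeIndex (tail⁺ _ _)       = 2F
  edgeIndex (head⁺ _ _ _ _)   = 3F
  edgeIndex (tail⁻ _ _)       = 0F
  edgeIndex (head⁻ _ _ _ _)   = 1F
  edgeIndex (line⁺ _ _ _ _)   = 2F
  edgeIndex (line⁻ _ _ _ _)   = 3F

  edge-neighbour : ∀ {u v} (e : Edge u v) → v ≡ neighbour u (edgeIndex e)
  edge-neighbour (column⁺ i h _ eq) = cong (inj₁ i ,_) eq
  edge-neighbour (column⁻ i h _ eq) = cong (inj₁ i ,_) (cycPred-unique eq)
  edge-neighbour (tail⁺ i h)        = refl
  edge-neighbour (head⁺ i j h eq)   = cong (λ t → inj₂ t , h) (cycPred-unique (sym eq))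
  edge-neighbour (tail⁻ i h)        = refl
  edge-neighbour (head⁻ i j h eq)   = cong (λ t → inj₁ t , h) (sym eq)
  edge-neighbour (line⁺ j _ h eq)   = cong (λ t → inj₂ t , h) eq
  edge-neighbour (line⁻ j _ h eq)   = cong (λ t → inj₂ t , h) (cycPred-unique eq)

  neighbours-unique : ∀ u → Unique (tabulate (neighbour u))
  neighbours-unique (inj₁ i , h) =
      ((cycSuc≢cycPred 2≤n h ∘′ ,-injectiveʳ) ∷ (λ ()) ∷ (λ ()) ∷ [])
    ∷ ((λ ()) ∷ (λ ()) ∷ [])
    ∷ ((cycPred-irrefl 1≤m i ∘′ inj₂-injective ∘′ ,-injectiveˡ) ∷ [])
    ∷ [] ∷ []
  neighbours-unique (inj₂ j , h) =
      ((cycSuc-irrefl 1≤m j ∘′ sym ∘′ inj₁-injective ∘′ ,-injectiveˡ) ∷ (λ ()) ∷ (λ ()) ∷ [])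
    ∷ ((λ ()) ∷ (λ ()) ∷ [])
    ∷ ((cycSuc≢cycPred 2≤m j ∘′ inj₂-injective ∘′ ,-injectiveˡ) ∷ [])
    ∷ [] ∷ []

  neighbourhood : ∀ u → Neighbourhood G u 4
  neighbourhood u = record
    { neighbour = neighbour u
    ; unique    = neighbours-unique u
    ; adjacent  = λ k → Edge⇒Adj (neighbour-edge u k)
    ; complete  = λ a → edgeIndex (Adj⇒Edge a) , edge-neighbour (Adj⇒Edge a)
    }

  maxDegree : MaxDegree G 4
  maxDegree = (λ u → 4 , Neighbourhood⇒HasDegree G (neighbourhood u) , ≤-refl)
            , (inj₁ 0F , 0F) , Neighbourhood⇒HasDegree G (neighbourhood (inj₁ 0F , 0F))

  no-embedding-with-fewer-than-5-pages : ∀ k → k < 5 → ¬ MatchingBookEmbedding G k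
  no-embedding-with-fewer-than-5-pages =
    regular-with-triangle⇒pages>degree G Adj-sym Adj-irrefl neighbourhood
      (Edge⇒Adj (tail⁺ 0F 0F))
      (Edge⇒Adj (line⁻ 0F (cycPred 0F) 0F (sym (cycSuc-cycPred 0F))))
      (Edge⇒Adj (head⁺ 0F (cycPred 0F) 0F (cycSuc-cycPred 0F)))

module FivePages (m n : ℕ) (2≤m : 2 ≤ m) (2≤n : 2 ≤ n) (n-odd : parity n ≡ 1ℙ) where

  open QSumOfCycles m n 2≤m 2≤n
  open Graph G using (Adj) renaming (V to Vertex)

  alternate : Parity → Fin 5
  alternate 0ℙ = 0F
  alternate 1ℙ = 1F

  columnPage : Fin q → Fin 5
  columnPage h = alternate (parity (toℕ h))

  headPage : Fin p → Fin 5
  headPage zero    = 4F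
  headPage (suc _) = 3F

  linePage : ℕ → Fin 5
  linePage zero    = 4F
  linePage (suc t) = alternate (parity (suc t))

  pageOf : ∀ {u v} → Edge u v → Fin 5
  pageOf (column⁺ _ h _ _)  = columnPage h
  pageOf (column⁻ _ _ h′ _) = columnPage h′
  pageOf (tail⁺ _ _)        = 2F
  pageOf (tail⁻ _ _)        = 2F
  pageOf (head⁺ i _ _ _)    = headPage i
  pageOf (head⁻ i _ _ _)    = headPage i
  pageOf (line⁺ j _ _ _)    = linePage (toℕ j)
  pageOf (line⁻ _ j′ _ _)   = linePage (toℕ j′)

  pageOf-sym : ∀ {u v} (e : Edge u v) (e′ : Edge v u) → pageOf e ≡ pageOf e′
  pageOf-sym (column⁺ _ _ _ _)     (column⁻ _ _ _ _)     = refl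
  pageOf-sym (column⁺ _ h _ refl)  (column⁺ _ _ _ eq)    = ⊥-elim (cycSuc²-irrefl 2≤n h (sym eq))
  pageOf-sym (column⁻ _ _ _ _)     (column⁺ _ _ _ _)     = refl
  pageOf-sym (column⁻ _ _ h′ refl) (column⁻ _ _ _ eq)    = ⊥-elim (cycSuc²-irrefl 2≤n h′ (sym eq))
  pageOf-sym (tail⁺ _ _)           (tail⁻ _ _)           = refl
  pageOf-sym (tail⁺ i _)           (head⁻ _ _ _ eq)      = ⊥-elim (cycSuc-irrefl 1≤m i eq)
  pageOf-sym (tail⁻ _ _)           (tail⁺ _ _)           = refl
  pageOf-sym (tail⁻ i _)           (head⁺ _ _ _ eq)      = ⊥-elim (cycSuc-irrefl 1≤m i eq)
  pageOf-sym (head⁺ _ _ _ _)       (head⁻ _ _ _ _)       = refl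
  pageOf-sym (head⁺ _ j _ eq)      (tail⁻ _ _)           = ⊥-elim (cycSuc-irrefl 1≤m j eq)
  pageOf-sym (head⁻ _ _ _ _)       (head⁺ _ _ _ _)       = refl
  pageOf-sym (head⁻ _ j _ eq)      (tail⁺ _ _)           = ⊥-elim (cycSuc-irrefl 1≤m j eq)
  pageOf-sym (line⁺ _ _ _ _)       (line⁻ _ _ _ _)       = refl
  pageOf-sym (line⁺ j _ _ refl)    (line⁺ _ _ _ eq)      = ⊥-elim (cycSuc²-irrefl 2≤m j (sym eq))
  pageOf-sym (line⁻ _ _ _ _)       (line⁺ _ _ _ _)       = refl
  pageOf-sym (line⁻ _ j′ _ refl)   (line⁻ _ _ _ eq)      = ⊥-elim (cycSuc²-irrefl 2≤m j′ (sym eq))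

  neighbourPage : Vertex → Fin 4 → Fin 5
  neighbourPage (inj₁ i , h) 0F = columnPage h
  neighbourPage (inj₁ i , h) 1F = columnPage (cycPred h)
  neighbourPage (inj₁ i , h) 2F = 2F
  neighbourPage (inj₁ i , h) 3F = headPage i
  neighbourPage (inj₂ j , h) 0F = 2F
  neighbourPage (inj₂ j , h) 1F = headPage (cycSuc j)
  neighbourPage (inj₂ j , h) 2F = linePage (toℕ j)
  neighbourPage (inj₂ j , h) 3F = linePage (toℕ (cycPred j))

  pageOf≡neighbourPage : ∀ {u v} (e : Edge u v) → pageOf e ≡ neighbourPage u (edgeIndex e)
  pageOf≡neighbourPage (column⁺ _ _ _ _)     = refl
  pageOf≡neighbourPage (column⁻ _ _ h′ refl) = cong columnPage (sym (cycPred-cycSuc h′))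
  pageOf≡neighbourPage (tail⁺ _ _)           = refl
  pageOf≡neighbourPage (head⁺ _ _ _ _)       = refl
  pageOf≡neighbourPage (tail⁻ _ _)           = refl
  pageOf≡neighbourPage (head⁻ _ _ _ eq)      = cong headPage (sym eq)
  pageOf≡neighbourPage (line⁺ _ _ _ _)       = refl
  pageOf≡neighbourPage (line⁻ _ j′ _ refl)   = cong (linePage ∘′ toℕ) (sym (cycPred-cycSuc j′))

  alternate-injective : ∀ {β γ} → alternate β ≡ alternate γ → β ≡ γ
  alternate-injective {0ℙ} {0ℙ} _ = refl
  alternate-injective {1ℙ} {1ℙ} _ = refl

  alternate≢2F : ∀ β → alternate β ≢ 2F
  alternate≢2F 0ℙ ()
  alternate≢2F 1ℙ ()

  alternate≢headPage : ∀ β i → alternate β ≢ headPage i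
  alternate≢headPage 0ℙ zero    ()
  alternate≢headPage 0ℙ (suc _) ()
  alternate≢headPage 1ℙ zero    ()
  alternate≢headPage 1ℙ (suc _) ()

  2F≢headPage : ∀ i → 2F ≢ headPage i
  2F≢headPage zero    ()
  2F≢headPage (suc _) ()

  2F≢linePage : ∀ t → 2F ≢ linePage t
  2F≢linePage zero    ()
  2F≢linePage (suc t) = alternate≢2F _ ∘′ sym

  headPage≡linePage⇒zero : ∀ i t → headPage i ≡ linePage t → i ≡ zero × t ≡ 0
  headPage≡linePage⇒zero zero    zero    _  = refl , refl
  headPage≡linePage⇒zero i       (suc t) eq = ⊥-elim (alternate≢headPage _ i (sym eq))
  headPage≡linePage⇒zero (suc _) zero    ()

  columnPage-cycSuc : (h : Fin q) → columnPage (cycSuc h) ≢ columnPage h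
  columnPage-cycSuc h eq =
    p≢p⁻¹ (parity (toℕ h)) (trans (sym (alternate-injective eq)) (cycSuc-parity n-odd h))

  linePage-suc : ∀ t → linePage (suc t) ≢ linePage t
  linePage-suc zero    eq = alternate≢headPage _ zero eq
  linePage-suc (suc t) eq =
    p≢p⁻¹ (parity (suc t)) (trans (sym (alternate-injective eq)) (parity-suc (suc t)))

  linePage-cycSuc : (j : Fin p) → linePage (toℕ (cycSuc j)) ≢ linePage (toℕ j)
  linePage-cycSuc j with cycSucView j
  ... | step _ si  = subst (λ t → linePage t ≢ linePage (toℕ j)) (sym si) (linePage-suc (toℕ j))
  ... | wrap j≡m si =
    subst₂ (λ t t′ → linePage t ≢ linePage t′) (sym si) (sym j≡m) (wrap-distinct m 1≤m)
    where
    wrap-distinct : ∀ t → 1 ≤ t → linePage 0 ≢ linePage t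
    wrap-distinct (suc t) _ eq = alternate≢headPage _ zero (sym eq)

  neighbourPages-unique : ∀ u → Unique (tabulate (neighbourPage u))
  neighbourPages-unique (inj₁ i , h) =
      (column-pages-distinct ∷ alternate≢2F _ ∷ alternate≢headPage _ i ∷ [])
    ∷ (alternate≢2F _ ∷ alternate≢headPage _ i ∷ [])
    ∷ (2F≢headPage i ∷ [])
    ∷ [] ∷ []
    where
    column-pages-distinct : columnPage h ≢ columnPage (cycPred h)
    column-pages-distinct = subst (λ h′ → columnPage h′ ≢ columnPage (cycPred h)) (cycSuc-cycPred h)
                                  (columnPage-cycSuc (cycPred h))
  neighbourPages-unique (inj₂ j , h) =
      (2F≢headPage (cycSuc j) ∷ 2F≢linePage (toℕ j) ∷ 2F≢linePage (toℕ (cycPred j)) ∷ [])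
    ∷ (head≢line-here ∷ head≢line-before ∷ [])
    ∷ (line-pages-distinct ∷ [])
    ∷ [] ∷ []
    where
    toℕ≡0 : ∀ {i : Fin p} → toℕ i ≡ 0 → i ≡ zero
    toℕ≡0 = toℕ-injective
    head≢line-here : headPage (cycSuc j) ≢ linePage (toℕ j)
    head≢line-here eq with headPage≡linePage⇒zero _ _ eq
    ... | cs≡0 , j≡0 = cycSuc-irrefl 1≤m zero (subst (λ i → cycSuc i ≡ zero) (toℕ≡0 j≡0) cs≡0)
    head≢line-before : headPage (cycSuc j) ≢ linePage (toℕ (cycPred j))
    head≢line-before eq with headPage≡linePage⇒zero _ _ eq
    ... | cs≡0 , pj≡0 = cycSuc²-irrefl 2≤m zero
      (subst (λ i → cycSuc i ≡ zero) (trans (sym (cycSuc-cycPred j)) (cong cycSuc (toℕ≡0 pj≡0))) cs≡0)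
    line-pages-distinct : linePage (toℕ j) ≢ linePage (toℕ (cycPred j))
    line-pages-distinct = subst (λ j′ → linePage (toℕ j′) ≢ linePage (toℕ (cycPred j)))
                                (cycSuc-cycPred j) (linePage-cycSuc (cycPred j))

  edge-pages-at-vertex-distinct : ∀ {u v w} (e : Edge u v) (e′ : Edge u w) → v ≢ w → pageOf e ≢ pageOf e′
  edge-pages-at-vertex-distinct {u} e e′ v≢w eq = v≢w (begin
    _                           ≡⟨ edge-neighbour e ⟩
    neighbour u (edgeIndex e)   ≡⟨ cong (neighbour u) (neighbourPage-injective same-page) ⟩
    neighbour u (edgeIndex e′)  ≡⟨ edge-neighbour e′ ⟨
    _                           ∎)
    where
    open ≡-Reasoning
    neighbourPage-injective : Injective _≡_ _≡_ (neighbourPage u)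
    neighbourPage-injective = Unique-tabulate⇒injective (neighbourPages-unique u)
    same-page : neighbourPage u (edgeIndex e) ≡ neighbourPage u (edgeIndex e′)
    same-page = trans (sym (pageOf≡neighbourPage e)) (trans eq (pageOf≡neighbourPage e′))

  W Wm : ℕ
  W  = p + p
  Wm = m + p

  -- Layer h occupies the positions W h, …, W h + W − 1 of the spine, in the order
  -- v₀ … v_{p−1} e_{p−1} … e₀, reversed when h is odd.
  slot : Fin p ⊎ Fin p → Fin W
  slot (inj₁ i) = i ↑ˡ p
  slot (inj₂ j) = p ↑ʳ opposite j

  unslot : Fin W → Fin p ⊎ Fin p
  unslot l = Sum.map₂ opposite (splitAt p l)

  unslot-slot : ∀ s → unslot (slot s) ≡ s
  unslot-slot (inj₁ i) = cong (Sum.map₂ opposite) (splitAt-↑ˡ p i p)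
  unslot-slot (inj₂ j) =
    trans (cong (Sum.map₂ opposite) (splitAt-↑ʳ p p (opposite j))) (cong inj₂ (opposite-involutive j))

  slot-unslot : ∀ l → slot (unslot l) ≡ l
  slot-unslot l with splitAt p l in eq
  ... | inj₁ i = trans (cong (join p p) (sym eq)) (join-splitAt p p l)
  ... | inj₂ j =
    trans (cong (p ↑ʳ_) (opposite-involutive j)) (trans (cong (join p p) (sym eq)) (join-splitAt p p l))

  orient : Parity → Fin W → Fin W
  orient 0ℙ l = l
  orient 1ℙ l = opposite l

  orient-involutive : ∀ b l → orient b (orient b l) ≡ l
  orient-involutive 0ℙ l = refl
  orient-involutive 1ℙ l = opposite-involutive l

  toSpine : Vertex → Fin (q * W)
  toSpine (s , h) = combine h (orient (parity (toℕ h)) (slot s))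

  fromLayer : Fin q × Fin W → Vertex
  fromLayer (h , l) = unslot (orient (parity (toℕ h)) l) , h

  fromSpine : Fin (q * W) → Vertex
  fromSpine k = fromLayer (remQuot W k)

  spine : Vertex ↔ Fin (q * W)
  spine = mk↔ₛ′ toSpine fromSpine to-from from-to
    where
    to-fromLayer : ∀ x → toSpine (fromLayer x) ≡ uncurry combine x
    to-fromLayer (h , l) = cong (combine h) (begin
      orient b (slot (unslot (orient b l))) ≡⟨ cong (orient b) (slot-unslot _) ⟩
      orient b (orient b l)                 ≡⟨ orient-involutive b l ⟩
      l                                     ∎)
      where
      open ≡-Reasoning
      b : Parity
      b = parity (toℕ h)
    to-from : ∀ k → toSpine (fromSpine k) ≡ k
    to-from k = trans (to-fromLayer (remQuot W k)) (combine-remQuot {q} W k)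
    from-to : ∀ v → fromSpine (toSpine v) ≡ v
    from-to (s , h) = begin
      fromLayer (remQuot W (combine h (orient b (slot s))))
        ≡⟨ cong fromLayer (remQuot-combine h _) ⟩
      unslot (orient b (orient b (slot s))) , h
        ≡⟨ cong (λ l → unslot l , h) (orient-involutive b _) ⟩
      unslot (slot s) , h
        ≡⟨ cong (_, h) (unslot-slot s) ⟩
      s , h
        ∎
      where
      open ≡-Reasoning
      b : Parity
      b = parity (toℕ h)

  position : Vertex → ℕ
  position v = toℕ (toSpine v)

  offset : Parity → Fin p ⊎ Fin p → ℕ
  offset b s = toℕ (orient b (slot s))

  offset-flip : ∀ b s → offset b s + offset (b ⁻¹) s ≡ Wm
  offset-flip 0ℙ s = trans (+-comm (toℕ (slot s)) _) (opposite-sum (slot s))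
  offset-flip 1ℙ s = opposite-sum (slot s)

  offset-vertex : ∀ i → offset 0ℙ (inj₁ i) ≡ toℕ i
  offset-vertex i = toℕ-↑ˡ i p

  offset-edge : ∀ j → offset 0ℙ (inj₂ j) ≡ p + toℕ (opposite j)
  offset-edge j = toℕ-↑ʳ p (opposite j)

  record Layered (a h l : ℕ) : Set where
    constructor layered
    field
      offset<W  : l < W
      position≡ : a ≡ W * h + l

  vertex-layered : ∀ s h {t} → toℕ h ≡ t → Layered (position (s , h)) t (offset (parity t) s)
  vertex-layered s h refl = layered (toℕ<n _) (toℕ-combine h _)

  VertexRegion : Parity → ℕ → Set
  VertexRegion 0ℙ l = l < p
  VertexRegion 1ℙ l = p ≤ l

  vertex-region : ∀ b i → VertexRegion b (offset b (inj₁ i))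
  vertex-region 0ℙ i = subst (_< p) (sym (offset-vertex i)) (toℕ<n i)
  vertex-region 1ℙ i = +-cancelʳ-≤ (toℕ i) p _ (begin
    p + toℕ i                                ≡⟨ +-comm p (toℕ i) ⟩
    toℕ i + p                                ≤⟨ +-monoˡ-≤ p (s≤s⁻¹ (toℕ<n i)) ⟩
    m + p                                    ≡⟨ offset-flip 1ℙ (inj₁ i) ⟨
    offset 1ℙ (inj₁ i) + offset 0ℙ (inj₁ i)  ≡⟨ cong (offset 1ℙ (inj₁ i) +_) (offset-vertex i) ⟩
    offset 1ℙ (inj₁ i) + toℕ i               ∎)
    where open ≤-Reasoning

  regions-separate : ∀ b {la lb lz} → VertexRegion (b ⁻¹) la → VertexRegion (b ⁻¹) lb →
                     VertexRegion b lz → la < lz → lz < lb → ⊥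
  regions-separate 0ℙ p≤la _ lz<p la<lz _ = <-irrefl refl (<-trans (≤-<-trans p≤la la<lz) lz<p)
  regions-separate 1ℙ _ lb<p p≤lz _ lz<lb = <-irrefl refl (<-trans (≤-<-trans p≤lz lz<lb) lb<p)

  -- The offsets of the ends of a long in-layer arc on page c, in a layer of parity b, add up to
  -- layerSum c b, so these arcs are concentric.
  layerSum : Fin 5 → Parity → ℕ
  layerSum 0F 0ℙ = p + (m + p)
  layerSum 0F 1ℙ = m
  layerSum 1F 0ℙ = p + (m + p)
  layerSum 1F 1ℙ = m
  layerSum 2F _  = m + p
  layerSum 3F 0ℙ = p + p
  layerSum 3F 1ℙ = m + m
  layerSum 4F 0ℙ = p
  layerSum 4F 1ℙ = m + (m + p)

  layerSum-mirror : ∀ c → layerSum c 1ℙ + layerSum c 0ℙ ≡ Wm + Wm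
  layerSum-mirror 0F = alternating-mirror m
    where
    alternating-mirror : ∀ a → a + (suc a + (a + suc a)) ≡ (a + suc a) + (a + suc a)
    alternating-mirror = solve-∀
  layerSum-mirror 1F = layerSum-mirror 0F
  layerSum-mirror 2F = refl
  layerSum-mirror 3F = head-mirror m
    where
    head-mirror : ∀ a → (a + a) + (suc a + suc a) ≡ (a + suc a) + (a + suc a)
    head-mirror = solve-∀
  layerSum-mirror 4F = first-head-mirror m
    where
    first-head-mirror : ∀ a → (a + (a + suc a)) + suc a ≡ (a + suc a) + (a + suc a)
    first-head-mirror = solve-∀

  layerSum-alternate : ∀ β b → layerSum (alternate β) b ≡ layerSum 0F b
  layerSum-alternate 0ℙ _  = refl
  layerSum-alternate 1ℙ 0ℙ = refl
  layerSum-alternate 1ℙ 1ℙ = refl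

  layerSum-linePage : ∀ t b → 1 ≤ t → layerSum (linePage t) b ≡ layerSum 0F b
  layerSum-linePage (suc t) b _ = layerSum-alternate (parity (suc t)) b

  slot-sum⇒layer-sum : ∀ b c s t → offset 0ℙ s + offset 0ℙ t ≡ layerSum c 0ℙ →
                       offset b s + offset b t ≡ layerSum c b
  slot-sum⇒layer-sum 0ℙ c s t eq = eq
  slot-sum⇒layer-sum 1ℙ c s t eq = +-cancelʳ-≡ (layerSum c 0ℙ) _ _ (begin
    (s₁ + t₁) + layerSum c 0ℙ  ≡⟨ cong ((s₁ + t₁) +_) eq ⟨
    (s₁ + t₁) + (s₀ + t₀)      ≡⟨ +-interchange s₁ t₁ s₀ t₀ ⟩
    (s₁ + s₀) + (t₁ + t₀)      ≡⟨ cong₂ _+_ (offset-flip 1ℙ s) (offset-flip 1ℙ t) ⟩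
    Wm + Wm                    ≡⟨ layerSum-mirror c ⟨
    layerSum c 1ℙ + layerSum c 0ℙ ∎)
    where
    open ≡-Reasoning
    s₀ s₁ t₀ t₁ : ℕ
    s₀ = offset 0ℙ s
    s₁ = offset 1ℙ s
    t₀ = offset 0ℙ t
    t₁ = offset 1ℙ t
    +-interchange : ∀ a b c d → (a + b) + (c + d) ≡ (a + c) + (b + d)
    +-interchange = solve-∀

  alternating-arc-in-edge-region : ∀ b {la lb} → lb < W → la + lb ≡ layerSum 0F b →
                                   VertexRegion (b ⁻¹) la
  alternating-arc-in-edge-region 0ℙ {la} {lb} lb<W eq = ≮⇒≥ λ la<p →
    <-irrefl eq (s≤s (+-mono-≤ (s≤s⁻¹ la<p) (s≤s⁻¹ lb<W)))
  alternating-arc-in-edge-region 1ℙ {la} {lb} _ eq = s≤s (subst (la ≤_) eq (m≤m+n la lb))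

  layer-start : ∀ {a h l} → Layered a h l → W * h ≤ a
  layer-start {h = h} {l} (layered _ refl) = m≤m+n (W * h) l

  layer-end : ∀ {a h l} → Layered a h l → a < W * suc h
  layer-end {h = h} {l} (layered l<W refl) = begin-strict
    W * h + l <⟨ +-monoʳ-< (W * h) l<W ⟩
    W * h + W ≡⟨ +-comm (W * h) W ⟩
    W + W * h ≡⟨ *-suc W h ⟨
    W * suc h ∎
    where open ≤-Reasoning

  layer-monotone : ∀ {a b h k la lb} → Layered a h la → Layered b k lb → a ≤ b → h ≤ k
  layer-monotone {h = h} {k} A B a≤b =
    s≤s⁻¹ (*-cancelˡ-< W h (suc k) (≤-<-trans (≤-trans (layer-start A) a≤b) (layer-end B)))

  lower-layer-first : ∀ {a b h k la lb} → Layered a h la → Layered b k lb → h < k → a < b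
  lower-layer-first {h = h} {k} A B h<k =
    <-≤-trans (layer-end A) (≤-trans (*-monoʳ-≤ W h<k) (layer-start B))

  inside-same-layer : ∀ {a b x h k la lb lx} → Layered a h la → Layered b h lb → Layered x k lx →
                      a < x → x < b → k ≡ h
  inside-same-layer A B X a<x x<b =
    ≤-antisym (layer-monotone X B (<⇒≤ x<b)) (layer-monotone A X (<⇒≤ a<x))

  offset-monotone : ∀ {a b h la lb} → Layered a h la → Layered b h lb → a < b → la < lb
  offset-monotone {h = h} (layered _ refl) (layered _ refl) = +-cancelˡ-< (W * h) _ _

  layered-sum : ∀ {a b h k la lb} → Layered a h la → Layered b k lb → a + b ≡ (W * h + W * k) + (la + lb)
  layered-sum {h = h} {k} {la} {lb} (layered _ refl) (layered _ refl) = interchange (W * h) la (W * k) lb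
    where
    interchange : ∀ a b c d → (a + b) + (c + d) ≡ (a + c) + (b + d)
    interchange = solve-∀

  layered-sums-agree : ∀ {a b x y h k la lb lx ly} → Layered a h la → Layered b k lb →
                       Layered x h lx → Layered y k ly → la + lb ≡ lx + ly → a + b ≡ x + y
  layered-sums-agree {h = h} {k} A B X Y eq =
    trans (layered-sum A B) (trans (cong (W * h + W * k +_) eq) (sym (layered-sum X Y)))

  concentric-arcs-do-not-cross : ∀ {a b x y} → a + b ≡ x + y → a < x → b < y → ⊥
  concentric-arcs-do-not-cross eq a<x b<y = <⇒≢ (+-mono-< a<x b<y) eq

  -- How an edge on page c can sit between spine positions a and b; columnWrap is an edge of C_q
  -- between the last layer n and layer 0.
  data Arc (c : Fin 5) (a b : ℕ) : Set where
    short      : b ≡ suc a → Arc c a b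
    inLayer    : ∀ {h la lb} → Layered a h la → Layered b h lb → la + lb ≡ layerSum c (parity h) →
                 Arc c a b
    column     : ∀ {h la lb} → Layered a h la → Layered b (suc h) lb → la + lb ≡ Wm →
                 VertexRegion (parity h) la → VertexRegion (parity (suc h)) lb → suc h ≤ n →
                 c ≡ alternate (parity h) → Arc c a b
    columnWrap : ∀ {la lb} → Layered a 0 la → Layered b n lb → la + lb ≡ Wm →
                 VertexRegion 0ℙ la → VertexRegion (parity n) lb → c ≡ alternate 1ℙ → Arc c a b

  -- On the two alternating pages the only long in-layer arc is e_{p−1} e₀, and it spans exactly the
  -- subdivision vertices of its layer.
  vertex-inside-alternating-arc : ∀ {β a b z h k la lb lz} →
    Layered a h la → Layered b h lb → la + lb ≡ layerSum (alternate β) (parity h) →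
    Layered z k lz → VertexRegion (parity k) lz → a < z → z < b → ⊥
  vertex-inside-alternating-arc {β} {h = h} {la = la} {lb} A B sum Z vz a<z z<b
    with inside-same-layer A B Z a<z z<b
  ... | refl = regions-separate (parity h)
                 (alternating-arc-in-edge-region (parity h) (Layered.offset<W B) sum′)
                 (alternating-arc-in-edge-region (parity h) (Layered.offset<W A) (trans (+-comm lb la) sum′))
                 vz (offset-monotone A Z a<z) (offset-monotone Z B z<b)
    where
    sum′ : la + lb ≡ layerSum 0F (parity h)
    sum′ = trans sum (layerSum-alternate β (parity h))

  arcs-do-not-cross : ∀ {c a b x y} → Arc c a b → Arc c x y → a < x → x < b → b < y → ⊥
  arcs-do-not-cross (short refl) _ a<x x<b _ = <⇒≱ a<x (s≤s⁻¹ x<b)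
  arcs-do-not-cross _ (short refl) _ x<b b<y = <⇒≱ x<b (s≤s⁻¹ b<y)
  arcs-do-not-cross (inLayer A B s) (inLayer X Y s′) a<x x<b b<y with inside-same-layer A B X a<x x<b
  ... | refl = concentric-arcs-do-not-cross (layered-sums-agree A B X Y (trans s (sym s′))) a<x b<y
  arcs-do-not-cross (inLayer A B s) (column {k} X _ _ vx _ _ refl) a<x x<b _ =
    vertex-inside-alternating-arc {β = parity k} A B s X vx a<x x<b
  arcs-do-not-cross (inLayer A B s) (columnWrap X _ _ vx _ refl) a<x x<b _ =
    vertex-inside-alternating-arc {β = 1ℙ} A B s X vx a<x x<b
  arcs-do-not-cross (column {h} _ B _ _ vb _ refl) (inLayer X Y s) _ x<b b<y =
    vertex-inside-alternating-arc {β = parity h} X Y s B vb x<b b<y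
  arcs-do-not-cross (columnWrap _ B _ _ vb refl) (inLayer X Y s) _ x<b b<y =
    vertex-inside-alternating-arc {β = 1ℙ} X Y s B vb x<b b<y
  arcs-do-not-cross (column {h} A B s _ _ _ pc) (column {k} X Y s′ _ _ _ pc′) a<x x<b b<y
    with m≤n⇒m<n∨m≡n (layer-monotone A X (<⇒≤ a<x))
  ... | inj₂ refl = concentric-arcs-do-not-cross (layered-sums-agree A B X Y (trans s (sym s′))) a<x b<y
  ... | inj₁ h<k  = p≢p⁻¹ (parity h) (begin
    parity h        ≡⟨ alternate-injective (trans (sym pc) pc′) ⟩
    parity k        ≡⟨ cong parity (≤-antisym (layer-monotone X B (<⇒≤ x<b)) h<k) ⟩
    parity (suc h)  ≡⟨ parity-suc h ⟩
    parity h ⁻¹     ∎)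
    where open ≡-Reasoning
  arcs-do-not-cross (column A _ _ _ _ _ pc) (columnWrap X _ _ _ _ pc′) a<x _ _
    with layer-monotone A X (<⇒≤ a<x)
  ... | z≤n with trans (sym pc) pc′
  ...   | ()
  arcs-do-not-cross (columnWrap _ B _ _ _ pc) (column {k} _ Y _ _ _ k<n pc′) _ _ b<y = p≢p⁻¹ 1ℙ (begin
    1ℙ               ≡⟨ n-odd ⟨
    parity n         ≡⟨ cong parity (≤-antisym (layer-monotone B Y (<⇒≤ b<y)) k<n) ⟩
    parity (suc k)   ≡⟨ parity-suc k ⟩
    parity k ⁻¹      ≡⟨ cong _⁻¹ (alternate-injective (trans (sym pc) pc′)) ⟨
    1ℙ ⁻¹            ∎)
    where open ≡-Reasoning
  arcs-do-not-cross (columnWrap A B s _ _ _) (columnWrap X Y s′ _ _ _) a<x _ b<y =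
    concentric-arcs-do-not-cross (layered-sums-agree A B X Y (trans s (sym s′))) a<x b<y

  reverse-arc : ∀ {c a b} → a < b → Arc c b a → Arc c a b
  reverse-arc a<b (short refl)                   = ⊥-elim (<-asym a<b (n<1+n _))
  reverse-arc a<b (inLayer {la = lb} {la} B A s) = inLayer A B (trans (+-comm la lb) s)
  reverse-arc a<b (column B A _ _ _ _ _)         = ⊥-elim (<-asym a<b (lower-layer-first B A (n<1+n _)))
  reverse-arc a<b (columnWrap B A _ _ _ _)       = ⊥-elim (<-asym a<b (lower-layer-first B A 1≤n))

  Arc⇆ : Fin 5 → ℕ → ℕ → Set
  Arc⇆ c a b = Arc c a b ⊎ Arc c b a

  orient-arc : ∀ {c a b} → a < b → Arc⇆ c a b → Arc c a b
  orient-arc a<b = Sum.[ id , reverse-arc a<b ]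

  vertex-position : ∀ s h → position (s , h) ≡ W * toℕ h + offset (parity (toℕ h)) s
  vertex-position s h = Layered.position≡ (vertex-layered s h refl)

  inLayerArc : ∀ c s t h → offset 0ℙ s + offset 0ℙ t ≡ layerSum c 0ℙ →
               Arc c (position (s , h)) (position (t , h))
  inLayerArc c s t h sum =
    inLayer (vertex-layered s h refl) (vertex-layered t h refl) (slot-sum⇒layer-sum _ c s t sum)

  consecutive-offsets : ∀ b s t → offset 0ℙ s ≡ suc (offset 0ℙ t) →
                        offset b s ≡ suc (offset b t) ⊎ offset b t ≡ suc (offset b s)
  consecutive-offsets 0ℙ s t eq = inj₁ eq
  consecutive-offsets 1ℙ s t eq = inj₂ (+-cancelʳ-≡ (offset 0ℙ t) _ _ (begin
    offset 1ℙ t + offset 0ℙ t         ≡⟨ offset-flip 1ℙ t ⟩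
    Wm                                ≡⟨ offset-flip 1ℙ s ⟨
    offset 1ℙ s + offset 0ℙ s         ≡⟨ cong (offset 1ℙ s +_) eq ⟩
    offset 1ℙ s + suc (offset 0ℙ t)   ≡⟨ +-suc _ _ ⟩
    suc (offset 1ℙ s) + offset 0ℙ t   ∎))
    where open ≡-Reasoning

  adjacent-offsets : ∀ s t h → offset (parity (toℕ h)) s ≡ suc (offset (parity (toℕ h)) t) →
                     position (s , h) ≡ suc (position (t , h))
  adjacent-offsets s t h eq = begin
    position (s , h)                        ≡⟨ vertex-position s h ⟩
    W * toℕ h + offset (parity (toℕ h)) s   ≡⟨ cong (W * toℕ h +_) eq ⟩
    W * toℕ h + suc (offset b t)            ≡⟨ +-suc (W * toℕ h) (offset b t) ⟩
    suc (W * toℕ h + offset b t)            ≡⟨ cong suc (vertex-position t h) ⟨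
    suc (position (t , h))                  ∎
    where
    open ≡-Reasoning
    b : Parity
    b = parity (toℕ h)

  shortArc : ∀ {c} s t h → offset 0ℙ s ≡ suc (offset 0ℙ t) →
             Arc⇆ c (position (s , h)) (position (t , h))
  shortArc s t h eq with consecutive-offsets (parity (toℕ h)) s t eq
  ... | inj₁ s≡1+t = inj₂ (short (adjacent-offsets s t h s≡1+t))
  ... | inj₂ t≡1+s = inj₁ (short (adjacent-offsets t s h t≡1+s))

  tail-slot-sum : ∀ i → offset 0ℙ (inj₁ i) + offset 0ℙ (inj₂ i) ≡ layerSum 2F 0ℙ
  tail-slot-sum i = begin
    offset 0ℙ (inj₁ i) + offset 0ℙ (inj₂ i)  ≡⟨ cong₂ _+_ (offset-vertex i) (offset-edge i) ⟩
    toℕ i + (p + toℕ (opposite i))           ≡⟨ rearrange (toℕ i) (toℕ (opposite i)) p ⟩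
    (toℕ (opposite i) + toℕ i) + p           ≡⟨ cong (_+ p) (opposite-sum i) ⟩
    m + p                                    ∎
    where
    open ≡-Reasoning
    rearrange : ∀ a b c → a + (c + b) ≡ (b + a) + c
    rearrange = solve-∀

  head-slot-sum : ∀ i j → cycSuc j ≡ i →
                  offset 0ℙ (inj₁ i) + offset 0ℙ (inj₂ j) ≡ layerSum (headPage i) 0ℙ
  head-slot-sum zero j eq = begin
    offset 0ℙ (inj₁ zero) + offset 0ℙ (inj₂ j)
      ≡⟨ cong₂ _+_ (offset-vertex zero) (offset-edge j) ⟩
    p + toℕ (opposite j)
      ≡⟨ cong (p +_) (toℕ-opposite-last (cycSuc≡zero⇒last eq)) ⟩
    p + 0
      ≡⟨ +-identityʳ p ⟩
    p
      ∎
    where open ≡-Reasoning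
  head-slot-sum (suc i) j eq = begin
    offset 0ℙ (inj₁ (suc i)) + offset 0ℙ (inj₂ j)
      ≡⟨ cong₂ _+_ (offset-vertex (suc i)) (offset-edge j) ⟩
    suc (toℕ i) + (p + toℕ (opposite j))
      ≡⟨ cong (λ t → suc t + _) (cycSuc≡suc⇒toℕ eq) ⟩
    suc (toℕ j) + (p + toℕ (opposite j))
      ≡⟨ rearrange (toℕ j) (toℕ (opposite j)) p ⟩
    p + suc (toℕ (opposite j) + toℕ j)
      ≡⟨ cong (λ t → p + suc t) (opposite-sum j) ⟩
    p + p
      ∎
    where
    open ≡-Reasoning
    rearrange : ∀ a b c → suc a + (c + b) ≡ c + suc (b + a)
    rearrange = solve-∀

  line-wrap-slot-sum : ∀ j → toℕ j ≡ m → toℕ (cycSuc j) ≡ 0 →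
                       offset 0ℙ (inj₂ j) + offset 0ℙ (inj₂ (cycSuc j)) ≡ layerSum 0F 0ℙ
  line-wrap-slot-sum j j≡m sj≡0 = begin
    offset 0ℙ (inj₂ j) + offset 0ℙ (inj₂ (cycSuc j))
      ≡⟨ cong₂ _+_ (offset-edge j) (offset-edge (cycSuc j)) ⟩
    (p + toℕ (opposite j)) + (p + toℕ (opposite (cycSuc j)))
      ≡⟨ cong₂ (λ a b → (p + a) + (p + b)) (toℕ-opposite-last j≡m) (toℕ-opposite-first sj≡0) ⟩
    (p + 0) + (p + m)
      ≡⟨ rearrange p m ⟩
    p + (m + p)
      ∎
    where
    open ≡-Reasoning
    rearrange : ∀ a b → (a + 0) + (a + b) ≡ a + (b + a)
    rearrange = solve-∀

  line-step-offsets : ∀ j → toℕ (cycSuc j) ≡ suc (toℕ j) →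
                      offset 0ℙ (inj₂ j) ≡ suc (offset 0ℙ (inj₂ (cycSuc j)))
  line-step-offsets j sj = begin
    offset 0ℙ (inj₂ j)                        ≡⟨ offset-edge j ⟩
    p + toℕ (opposite j)                      ≡⟨ cong (p +_) opposite-step ⟩
    p + suc (toℕ (opposite (cycSuc j)))       ≡⟨ +-suc p _ ⟩
    suc (p + toℕ (opposite (cycSuc j)))       ≡⟨ cong suc (offset-edge (cycSuc j)) ⟨
    suc (offset 0ℙ (inj₂ (cycSuc j)))         ∎
    where
    open ≡-Reasoning
    opposite-step : toℕ (opposite j) ≡ suc (toℕ (opposite (cycSuc j)))
    opposite-step = +-cancelʳ-≡ (toℕ j) _ _ (begin
      toℕ (opposite j) + toℕ j                       ≡⟨ opposite-sum j ⟩
      m                                              ≡⟨ opposite-sum (cycSuc j) ⟨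
      toℕ (opposite (cycSuc j)) + toℕ (cycSuc j)     ≡⟨ cong (toℕ (opposite (cycSuc j)) +_) sj ⟩
      toℕ (opposite (cycSuc j)) + suc (toℕ j)        ≡⟨ +-suc _ _ ⟩
      suc (toℕ (opposite (cycSuc j))) + toℕ j        ∎)

  columnArc : ∀ i h → Arc⇆ (columnPage h) (position (inj₁ i , h)) (position (inj₁ i , cycSuc h))
  columnArc i h with cycSucView h
  ... | step h<n sh = inj₁ (column (vertex-layered s h refl) (vertex-layered s (cycSuc h) sh) mirrored
                                   (vertex-region _ i) (vertex-region _ i) h<n refl)
    where
    s : Fin p ⊎ Fin p
    s = inj₁ i
    b : Parity
    b = parity (toℕ h)
    mirrored : offset b s + offset (parity (suc (toℕ h))) s ≡ Wm
    mirrored = subst (λ β → offset b s + offset β s ≡ Wm) (sym (parity-suc (toℕ h))) (offset-flip b s)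
  ... | wrap h≡n sh = inj₂ (columnWrap (vertex-layered s (cycSuc h) sh) (vertex-layered s h h≡n) mirrored
                                       (vertex-region 0ℙ i) (vertex-region _ i) last-page)
    where
    s : Fin p ⊎ Fin p
    s = inj₁ i
    mirrored : offset 0ℙ s + offset (parity n) s ≡ Wm
    mirrored = subst (λ β → offset 0ℙ s + offset β s ≡ Wm) (sym n-odd) (offset-flip 0ℙ s)
    last-page : columnPage h ≡ alternate 1ℙ
    last-page = cong alternate (trans (cong parity h≡n) n-odd)

  lineArc : ∀ j h → Arc⇆ (linePage (toℕ j)) (position (inj₂ j , h)) (position (inj₂ (cycSuc j) , h))
  lineArc j h with cycSucView j
  ... | step _ sj   = shortArc (inj₂ j) (inj₂ (cycSuc j)) h (line-step-offsets j sj)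
  ... | wrap j≡m sj =
    inj₁ (inLayerArc _ (inj₂ j) (inj₂ (cycSuc j)) h (trans (line-wrap-slot-sum j j≡m sj) alternating))
    where
    alternating : layerSum 0F 0ℙ ≡ layerSum (linePage (toℕ j)) 0ℙ
    alternating = sym (layerSum-linePage (toℕ j) 0ℙ (subst (1 ≤_) (sym j≡m) 1≤m))

  edgeArc : ∀ {u v} (e : Edge u v) → Arc⇆ (pageOf e) (position u) (position v)
  edgeArc (column⁺ i h _ refl)  = columnArc i h
  edgeArc (column⁻ i _ h′ refl) = Sum.swap (columnArc i h′)
  edgeArc (tail⁺ i h)           = inj₁ (inLayerArc 2F (inj₁ i) (inj₂ i) h (tail-slot-sum i))
  edgeArc (tail⁻ i h)           = inj₂ (inLayerArc 2F (inj₁ i) (inj₂ i) h (tail-slot-sum i))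
  edgeArc (head⁺ i j h eq)      = inj₁ (inLayerArc (headPage i) (inj₁ i) (inj₂ j) h (head-slot-sum i j eq))
  edgeArc (head⁻ i j h eq)      = inj₂ (inLayerArc (headPage i) (inj₁ i) (inj₂ j) h (head-slot-sum i j eq))
  edgeArc (line⁺ j _ h refl)    = lineArc j h
  edgeArc (line⁻ _ j′ h refl)   = Sum.swap (lineArc j′ h)

  embedding : MatchingBookEmbedding G 5
  embedding = record
    { N         = q * W
    ; spine     = spine
    ; page      = λ _ _ a → pageOf (Adj⇒Edge a)
    ; page-edge = λ _ _ a b → pageOf-sym (Adj⇒Edge a) (Adj⇒Edge b)
    ; no-cross  = λ _ _ _ _ a b u<x x<v v<y same-page →
        arcs-do-not-cross (orient-arc (<-trans u<x x<v) (edgeArc (Adj⇒Edge a)))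
                          (subst (λ c → Arc c _ _) (sym same-page)
                                 (orient-arc (<-trans x<v v<y) (edgeArc (Adj⇒Edge b))))
                          u<x x<v v<y
    ; matching  = λ _ _ _ a b → edge-pages-at-vertex-distinct (Adj⇒Edge a) (Adj⇒Edge b)
    }

theorem3p5 : ∀ (p q : ℕ) → 3 ≤ p → 4 ≤ q → 2 ∣ q →
    NearlyDispersable (C p +Q C q) × MaxDegree (C p +Q C q) 4 × MBT (C p +Q C q) 5
theorem3p5 (suc m) (suc n) (s≤s 2≤m) (s≤s 3≤n) 2∣q = (4 , maxDegree , mbt) , maxDegree , mbt
  where
  2≤n : 2 ≤ n
  2≤n = ≤-trans (n≤1+n 2) 3≤n
  open QSumOfCycles m n 2≤m 2≤n
  mbt : MBT G 5
  mbt = FivePages.embedding m n 2≤m 2≤n (2∣suc⇒parity≡1ℙ 2∣q) , no-embedding-with-fewer-than-5-pages
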